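{- Let $N\ge2$ and let $q,\gamma,s_0,\xi_0$ be generic complex parameters. For $n\ge1$ and variables $u_1,\ldots,u_n,v_1,\ldots,v_n$ define \[\mathsf{M}^{(n)}_i(v)=\xi_0^{2i-n}v^{n-i-1}\Big\{(1-\gamma s_0\xi_0^{ -1}v)(v\xi_0^{ -1}-\gamma s_0)\prod_{l=1}^n\frac{1-qvu_l}{1-vu_l}-\gamma q^{n-i}(1-s_0\xi_0^{ -1}v)(qv\xi_0^{ -1}-s_0)\Big\},\quad i=1,\ldots,n,\] and \[\mathscr{M}_n^\gamma(u_1,\ldots,u_n\mid v_1,\ldots,v_n;s_0)=\prod_{i,j=1}^n(1-u_iv_j)\,\frac{\det\big[\mathsf{M}^{(n)}_i(v_j)\big]_{i,j=1}^n}{\prod_{1\le i<j\le n}(v_i-v_j)}.\] Then, setting $u_N=v_N^{ -1}$, \begin{align*} &\mathscr{M}_N^\gamma(u_1,\ldots,u_N\mid v_1,\ldots,v_N;s_0)\big|_{u_N=v_N^{ -1}}\\ &\quad=(1-q)(1-s_0\xi_0\gamma v_N^{ -1})(1-s_0\xi_0^{ -1}\gamma v_N)\prod_{j=1}^{N-1}(1-qv_N^{ -1}v_j)(1-qv_Nu_j)\;\mathscr{M}_{N-1}^\gamma(u_1,\ldots,u_{N-1}\mid v_1,\ldots,v_{N-1};s_0). \end{align*}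
   Context: Identities are of rational functions for generic values of variables and parameters. (The function $\mathsf{M}^{(n)}_i$ depends on $u_1,\ldots,u_n$.) -}

module Defs where

open import Level using (Level; _⊔_)
open import Algebra.Bundles using (CommutativeRing)
open import Data.Nat as ℕ using (ℕ; zero; suc; _<?_)
open import Data.Integer as ℤ using (ℤ; +_; -[1+_])
open import Data.Fin using (Fin; zero; suc; toℕ; fromℕ; inject₁; punchIn)
open import Relation.Nullary using (¬_; does)
open import Data.Bool using (if_then_else_)

record Field (c ℓ : Level) : Set (Level.suc (c ⊔ ℓ)) where
  field
    commutativeRing : CommutativeRing c ℓ
  open CommutativeRing commutativeRing public
  field
    _⁻¹     : Carrier → Carrier
    0≉1     : ¬ (0# ≈ 1#)
    inverse : ∀ x → ¬ (x ≈ 0#) → x * (x ⁻¹) ≈ 1#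

module FieldOps {c ℓ : Level} (F : Field c ℓ) where
  open Field F using (Carrier; _≈_; _≉_; _+_; _*_; -_; _-_; 0#; 1#; _⁻¹)

  _/_ : Carrier → Carrier → Carrier
  x / y = x * (y ⁻¹)

  cast : ℕ → Carrier
  cast zero    = 0#
  cast (suc n) = 1# + cast n

  CharZero : Set ℓ
  CharZero = ∀ n → cast (suc n) ≉ 0#

  _^_ : Carrier → ℕ → Carrier
  x ^ zero  = 1#
  x ^ suc n = x * (x ^ n)

  _^ℤ_ : Carrier → ℤ → Carrier
  x ^ℤ (+ n)     = x ^ n
  x ^ℤ -[1+ n ]  = (x ⁻¹) ^ suc n

  sumF : ∀ n → (Fin n → Carrier) → Carrier
  sumF zero    f = 0#
  sumF (suc n) f = f zero + sumF n (λ i → f (suc i))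

  prodF : ∀ n → (Fin n → Carrier) → Carrier
  prodF zero    f = 1#
  prodF (suc n) f = f zero * prodF n (λ i → f (suc i))

  sign : ℕ → Carrier
  sign zero    = 1#
  sign (suc k) = - sign k

  det : ∀ n → (Fin n → Fin n → Carrier) → Carrier
  det zero    A = 1#
  det (suc n) A =
    sumF (suc n) (λ j → sign (toℕ j) * (A zero j * det n (λ r k → A (suc r) (punchIn j k))))

  vandermonde : ∀ n → (Fin n → Carrier) → Carrier
  vandermonde n v =
    prodF n (λ i → prodF n (λ j → if does (toℕ i <? toℕ j) then v i - v j else 1#))

  snoc : ∀ n → (Fin n → Carrier) → Carrier → Fin (suc n) → Carrier
  snoc zero    f y zero    = y
  snoc (suc n) f y zero    = f zero
  snoc (suc n) f y (suc i) = snoc n (λ k → f (suc k)) y i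

  -- Mhat n q γ s₀ ξ₀ u i v  =  (∏_{l=1}^n (1 - v u_l)) · M^{(n)}_{i}(v),  with i = toℕ i + 1, i.e.
  -- ξ₀^{2i-n} v^{n-i-1} { (1-γ s₀ ξ₀⁻¹ v)(v ξ₀⁻¹ - γ s₀) ∏_l (1 - q v u_l)
  --                        - γ q^{n-i} (1 - s₀ ξ₀⁻¹ v)(q v ξ₀⁻¹ - s₀) ∏_l (1 - v u_l) }
  Mhat : ∀ n (q γ s₀ ξ₀ : Carrier) (u : Fin n → Carrier) (i : Fin n) (v : Carrier) → Carrier
  Mhat n q γ s₀ ξ₀ u i v =
    (ξ₀ ^ℤ ((+ 2) ℤ.* (+ suc (toℕ i)) ℤ.- (+ n)))
    * ((v ^ℤ ((+ n) ℤ.- (+ suc (toℕ i)) ℤ.- (+ 1)))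
    * ( ((1# - γ * s₀ * (ξ₀ ⁻¹) * v) * (v * (ξ₀ ⁻¹) - γ * s₀) * prodF n (λ l → 1# - q * v * u l))
      - (γ * (q ^ (n ℕ.∸ suc (toℕ i))) * (1# - s₀ * (ξ₀ ⁻¹) * v) * (q * v * (ξ₀ ⁻¹) - s₀)
          * prodF n (λ l → 1# - v * u l)) ))

  -- 𝓜ⁿ_γ(u | v; s₀) = ∏_{i,j}(1 - u_i v_j) det[M^{(n)}_i(v_j)] / ∏_{i<j}(v_i - v_j),
  -- with the factor ∏_l (1 - u_l v_j) absorbed into column j.
  scrM : ∀ n (q γ s₀ ξ₀ : Carrier) (u v : Fin n → Carrier) → Carrier
  scrM n q γ s₀ ξ₀ u v = det n (λ i j → Mhat n q γ s₀ ξ₀ u i (v j)) / vandermonde n v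

-- Put u_N = v_N⁻¹ and t = ξ₀² v_N⁻¹. Subtracting t times row i from row i + 1 of the N × N matrix
-- [M̂_i(v_j)] (the entries of 𝓜 with the factor ∏_l (1 - u_l v_j) absorbed) leaves the determinant
-- unchanged, and a direct computation turns row i + 1 into ξ₀ (1 - v_j/v_N)(1 - q v_j/v_N) M̂^{(N-1)}_i(v_j).
-- These rows vanish in the last column v_j = v_N, so expanding along it leaves the top-right entry times
-- the (N-1)-determinant with scaled columns. The column factors produce ∏_j (v_j - v_N), which cancels
-- against the Vandermonde product, and the remaining scalars collect into the stated prefactor.

module Submission where

open import Defs
open import Level using (Level)
open import Function using (_∘_)
open import Data.Nat as ℕ using (ℕ; zero; suc; _≤_)
import Data.Nat.Properties as ℕₚ
open import Data.Integer as ℤ using (ℤ; +_; -[1+_]; _⊖_; _◃_)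
import Data.Integer.Properties as ℤₚ
open import Data.Sign as Sign using (Sign)
open import Data.Fin using (Fin; zero; suc; toℕ; fromℕ; fromℕ<; inject₁; punchIn; punchOut; lift)
import Data.Fin.Properties as Finₚ
open import Data.Vec.Functional using (updateAt)
open import Data.Vec.Functional.Properties using (updateAt-updates; updateAt-minimal)
open import Data.Maybe using (Maybe; just; nothing)
open import Data.Bool using (if_then_else_)
open import Relation.Nullary using (¬_; yes; no; does)
open import Data.Empty using (⊥-elim)
open import Relation.Nullary.Decidable using (dec-true; dec-false)
open import Relation.Binary.PropositionalEquality as ≡ using (_≡_; _≢_; _≗_)
import Algebra.Solver.Ring.AlmostCommutativeRing as ACR

module Exponents where
  open import Data.Integer.Tactic.RingSolver using (solve-∀)
  open import Data.Integer using (_+_; _*_; _-_)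

  -- Exponents of ξ₀ and of v in row k (counted from 0) of Mhat m, i.e. 2i - m and m - i - 1 for i = k + 1.
  ξexp vexp : ℕ → ℕ → ℤ
  ξexp m k = + 2 * + suc k - + m
  vexp m k = + m - + suc k - + 1

  -- The solver treats + suc k as an atom, so it is rewritten to + 1 + + k first.
  private
    ξexp-suc-row′ : ∀ k n → + 2 * (+ 1 + (+ 1 + k)) - (+ 1 + n) ≡ (+ 2 * (+ 1 + k) - (+ 1 + n)) + + 2
    ξexp-suc-row′ = solve-∀
    ξexp-pred-size′ : ∀ k n → + 2 * (+ 1 + k) - n ≡ (+ 2 * (+ 1 + k) - (+ 1 + n)) + + 1
    ξexp-pred-size′ = solve-∀
    vexp-suc-row′ : ∀ k n → (+ 1 + n) - (+ 1 + (+ 1 + k)) - + 1 ≡ n - (+ 1 + k) - + 1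
    vexp-suc-row′ = solve-∀
    vexp-pred-size′ : ∀ k n → (+ 1 + n) - (+ 1 + k) - + 1 ≡ (n - (+ 1 + k) - + 1) + + 1
    vexp-pred-size′ = solve-∀
    ξexp-first′ : ∀ n → (+ 2 * + 1 - (+ 1 + n)) + n ≡ + 1
    ξexp-first′ = solve-∀
    vexp-first′ : ∀ n → (+ 1 + n) - + 1 - + 1 ≡ -[1+ 0 ] + n
    vexp-first′ = solve-∀

  ξexp-suc-row : ∀ n k → ξexp (suc n) (suc k) ≡ ξexp (suc n) k + + 2
  ξexp-suc-row n k rewrite ℤₚ.pos-+ 1 (suc k) | ℤₚ.pos-+ 1 k | ℤₚ.pos-+ 1 n = ξexp-suc-row′ (+ k) (+ n)

  ξexp-pred-size : ∀ n k → ξexp n k ≡ ξexp (suc n) k + + 1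
  ξexp-pred-size n k rewrite ℤₚ.pos-+ 1 k | ℤₚ.pos-+ 1 n = ξexp-pred-size′ (+ k) (+ n)

  vexp-suc-row : ∀ n k → vexp (suc n) (suc k) ≡ vexp n k
  vexp-suc-row n k rewrite ℤₚ.pos-+ 1 (suc k) | ℤₚ.pos-+ 1 k | ℤₚ.pos-+ 1 n = vexp-suc-row′ (+ k) (+ n)

  vexp-pred-size : ∀ n k → vexp (suc n) k ≡ vexp n k + + 1
  vexp-pred-size n k rewrite ℤₚ.pos-+ 1 k | ℤₚ.pos-+ 1 n = vexp-pred-size′ (+ k) (+ n)

  ξexp-first : ∀ n → ξexp (suc n) 0 + + n ≡ + 1
  ξexp-first n rewrite ℤₚ.pos-+ 1 n = ξexp-first′ (+ n)

  vexp-first : ∀ n → vexp (suc n) 0 ≡ -[1+ 0 ] + + n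
  vexp-first n rewrite ℤₚ.pos-+ 1 n = vexp-first′ (+ n)

module FieldSolver {c ℓ : Level} (F : Field c ℓ) where
  open Field F
  open import Algebra.Properties.Ring ring using (-1*x≈-x)
  open import Algebra.Properties.Semiring.Mult.TCOptimised semiring using (_×_; 1+×; ×-homo-+; ×1-homo-*)
  open import Algebra.Properties.AbelianGroup +-abelianGroup using (⁻¹-∙-comm)
  open import Algebra.Properties.Group +-group using (ε⁻¹≈ε; ⁻¹-involutive)
  open import Algebra.Properties.CommutativeSemigroup *-commutativeSemigroup using (interchange)
  open import Relation.Binary.Reasoning.Setoid setoid

  -- Integer coefficients let the normaliser decide cancellations such as x - x, which it cannot do
  -- with coefficients in F itself; the optimised _×_ makes con (+ 1) evaluate to 1# on the nose.
  ℤ⟦_⟧ : ℤ → Carrier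
  ℤ⟦ + n ⟧      = n × 1#
  ℤ⟦ -[1+ n ] ⟧ = - (suc n × 1#)

  ℤ⟦⊖⟧ : ∀ m n → ℤ⟦ m ⊖ n ⟧ ≈ m × 1# - n × 1#
  ℤ⟦⊖⟧ zero    zero    = sym (-‿inverseʳ 0#)
  ℤ⟦⊖⟧ zero    (suc n) = sym (+-identityˡ _)
  ℤ⟦⊖⟧ (suc m) zero    = sym (trans (+-congˡ ε⁻¹≈ε) (+-identityʳ _))
  ℤ⟦⊖⟧ (suc m) (suc n) = begin
    ℤ⟦ suc m ⊖ suc n ⟧             ≡⟨ ≡.cong ℤ⟦_⟧ (ℤₚ.[1+m]⊖[1+n]≡m⊖n m n) ⟩
    ℤ⟦ m ⊖ n ⟧                     ≈⟨ ℤ⟦⊖⟧ m n ⟩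
    m × 1# - n × 1#               ≈⟨ x-y≈[1+x]-[1+y] _ _ ⟩
    (1# + m × 1#) - (1# + n × 1#) ≈⟨ +-cong (1+× m 1#) (-‿cong (1+× n 1#)) ⟨
    suc m × 1# - suc n × 1#       ∎
    where
    x-y≈[1+x]-[1+y] : ∀ x y → x - y ≈ (1# + x) - (1# + y)
    x-y≈[1+x]-[1+y] x y = begin
      x - y                   ≈⟨ +-identityˡ _ ⟨
      0# + (x - y)            ≈⟨ +-congʳ (-‿inverseʳ 1#) ⟨
      (1# - 1#) + (x - y)     ≈⟨ +-assoc _ _ _ ⟩
      1# + (- 1# + (x - y))   ≈⟨ +-congˡ (+-congˡ (+-comm _ _)) ⟩
      1# + (- 1# + (- y + x)) ≈⟨ +-congˡ (+-assoc _ _ _) ⟨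
      1# + ((- 1# - y) + x)   ≈⟨ +-congˡ (+-comm _ _) ⟩
      1# + (x + (- 1# - y))   ≈⟨ +-assoc _ _ _ ⟨
      (1# + x) + (- 1# - y)   ≈⟨ +-congˡ (⁻¹-∙-comm _ _) ⟩
      (1# + x) - (1# + y)     ∎

  ℤ⟦+⟧ : ∀ x y → ℤ⟦ x ℤ.+ y ⟧ ≈ ℤ⟦ x ⟧ + ℤ⟦ y ⟧
  ℤ⟦+⟧ (+ m)    (+ n)    = ×-homo-+ 1# m n
  ℤ⟦+⟧ (+ m)    -[1+ n ] = ℤ⟦⊖⟧ m (suc n)
  ℤ⟦+⟧ -[1+ m ] (+ n)    = trans (ℤ⟦⊖⟧ n (suc m)) (+-comm _ _)
  ℤ⟦+⟧ -[1+ m ] -[1+ n ] = begin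
    - (suc (suc (m ℕ.+ n)) × 1#)    ≡⟨ ≡.cong (λ k → - (suc k × 1#)) (ℕₚ.+-suc m n) ⟨
    - ((suc m ℕ.+ suc n) × 1#)      ≈⟨ -‿cong (×-homo-+ 1# (suc m) (suc n)) ⟩
    - (suc m × 1# + suc n × 1#)     ≈⟨ ⁻¹-∙-comm _ _ ⟨
    - (suc m × 1#) + - (suc n × 1#) ∎

  ℤ⟦-⟧ : ∀ x → ℤ⟦ ℤ.- x ⟧ ≈ - ℤ⟦ x ⟧
  ℤ⟦-⟧ (+ zero)  = sym ε⁻¹≈ε
  ℤ⟦-⟧ (+ suc n) = refl
  ℤ⟦-⟧ -[1+ n ]  = sym (⁻¹-involutive _)

  ⟦_⟧ˢ : Sign → Carrier
  ⟦ Sign.+ ⟧ˢ = 1#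
  ⟦ Sign.- ⟧ˢ = - 1#

  ⟦*⟧ˢ : ∀ s t → ⟦ s Sign.* t ⟧ˢ ≈ ⟦ s ⟧ˢ * ⟦ t ⟧ˢ
  ⟦*⟧ˢ Sign.+ t      = sym (*-identityˡ _)
  ⟦*⟧ˢ Sign.- Sign.+ = sym (*-identityʳ _)
  ⟦*⟧ˢ Sign.- Sign.- = trans (sym (⁻¹-involutive 1#)) (sym (-1*x≈-x (- 1#)))

  ℤ⟦◃⟧ : ∀ s n → ℤ⟦ s ◃ n ⟧ ≈ ⟦ s ⟧ˢ * (n × 1#)
  ℤ⟦◃⟧ s      zero    = sym (zeroʳ _)
  ℤ⟦◃⟧ Sign.+ (suc n) = sym (*-identityˡ _)
  ℤ⟦◃⟧ Sign.- (suc n) = sym (-1*x≈-x _)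

  ℤ⟦⟧≈sign*abs : ∀ x → ℤ⟦ x ⟧ ≈ ⟦ ℤ.sign x ⟧ˢ * (ℤ.∣ x ∣ × 1#)
  ℤ⟦⟧≈sign*abs (+ n)    = sym (*-identityˡ _)
  ℤ⟦⟧≈sign*abs -[1+ n ] = ℤ⟦◃⟧ Sign.- (suc n)

  ℤ⟦*⟧ : ∀ x y → ℤ⟦ x ℤ.* y ⟧ ≈ ℤ⟦ x ⟧ * ℤ⟦ y ⟧
  ℤ⟦*⟧ x y = begin
    ℤ⟦ sx Sign.* sy ◃ ax ℕ.* ay ⟧             ≈⟨ ℤ⟦◃⟧ (sx Sign.* sy) (ax ℕ.* ay) ⟩
    ⟦ sx Sign.* sy ⟧ˢ * ((ax ℕ.* ay) × 1#)    ≈⟨ *-cong (⟦*⟧ˢ sx sy) (×1-homo-* ax ay) ⟩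
    (⟦ sx ⟧ˢ * ⟦ sy ⟧ˢ) * (ax × 1# * ay × 1#) ≈⟨ interchange _ _ _ _ ⟩
    (⟦ sx ⟧ˢ * ax × 1#) * (⟦ sy ⟧ˢ * ay × 1#) ≈⟨ *-cong (ℤ⟦⟧≈sign*abs x) (ℤ⟦⟧≈sign*abs y) ⟨
    ℤ⟦ x ⟧ * ℤ⟦ y ⟧                           ∎
    where
    sx sy : Sign
    sx = ℤ.sign x
    sy = ℤ.sign y
    ax ay : ℕ
    ax = ℤ.∣ x ∣
    ay = ℤ.∣ y ∣

  ℤ⟶F : ℤ.+-*-rawRing ACR.-Raw-AlmostCommutative⟶ ACR.fromCommutativeRing commutativeRing
  ℤ⟶F = record
    { ⟦_⟧ = ℤ⟦_⟧ ; +-homo = ℤ⟦+⟧ ; *-homo = ℤ⟦*⟧ ; -‿homo = ℤ⟦-⟧ ; 0-homo = refl ; 1-homo = refl }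

  ℤ⟦⟧-≟ : ∀ x y → Maybe (ℤ⟦ x ⟧ ≈ ℤ⟦ y ⟧)
  ℤ⟦⟧-≟ x y with x ℤₚ.≟ y
  ... | yes ≡.refl = just refl
  ... | no _       = nothing

  open import Algebra.Solver.Ring ℤ.+-*-rawRing (ACR.fromCommutativeRing commutativeRing) ℤ⟶F ℤ⟦⟧-≟ public
    using (solve; _:=_; _:+_; _:*_; _:-_; :-_; con)

module Proof {c ℓ : Level} (F : Field c ℓ) where
  open Field F hiding (zero)
  open FieldOps F
  open FieldSolver F
  open Exponents
  open import Algebra.Properties.Ring ring using (-‿distribˡ-*)
  open import Algebra.Properties.AbelianGroup +-abelianGroup using (⁻¹-∙-comm)
  open import Algebra.Properties.Group +-group using (ε⁻¹≈ε; x∙y⁻¹≈ε⇒x≈y)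
  open import Algebra.Properties.CommutativeSemigroup *-commutativeSemigroup
    using (interchange; x∙yz≈y∙xz)
  open import Algebra.Properties.CommutativeSemigroup +-commutativeSemigroup
    using () renaming (interchange to +-interchange)
  open import Relation.Binary.Reasoning.Setoid setoid

  1≉0 : 1# ≉ 0#
  1≉0 1≈0 = 0≉1 (sym 1≈0)

  ⁻¹-inverseˡ : ∀ {x} → x ≉ 0# → x ⁻¹ * x ≈ 1#
  ⁻¹-inverseˡ {x} x≉0 = trans (*-comm _ _) (inverse x x≉0)

  *-≉0 : ∀ {x y} → x ≉ 0# → y ≉ 0# → x * y ≉ 0#
  *-≉0 {x} {y} x≉0 y≉0 xy≈0 = y≉0 (begin
    y              ≈⟨ *-identityˡ y ⟨
    1# * y         ≈⟨ *-congʳ (⁻¹-inverseˡ x≉0) ⟨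
    x ⁻¹ * x * y   ≈⟨ *-assoc _ _ _ ⟩
    x ⁻¹ * (x * y) ≈⟨ *-congˡ xy≈0 ⟩
    x ⁻¹ * 0#      ≈⟨ zeroʳ _ ⟩
    0#             ∎)

  x≉y⇒x-y≉0 : ∀ {x y} → x ≉ y → x - y ≉ 0#
  x≉y⇒x-y≉0 x≉y x-y≈0 = x≉y (x∙y⁻¹≈ε⇒x≈y _ _ x-y≈0)

  inverse-unique : ∀ {x y z} → x * y ≈ 1# → x * z ≈ 1# → y ≈ z
  inverse-unique {x} {y} {z} xy≈1 xz≈1 = begin
    y            ≈⟨ *-identityʳ y ⟨
    y * 1#       ≈⟨ *-congˡ xz≈1 ⟨
    y * (x * z)  ≈⟨ x∙yz≈y∙xz y x z ⟩
    x * (y * z)  ≈⟨ *-assoc _ _ _ ⟨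
    (x * y) * z  ≈⟨ *-congʳ xy≈1 ⟩
    1# * z       ≈⟨ *-identityˡ z ⟩
    z            ∎

  ⁻¹-cong : ∀ {x y} → x ≉ 0# → x ≈ y → x ⁻¹ ≈ y ⁻¹
  ⁻¹-cong {x} {y} x≉0 x≈y =
    inverse-unique (inverse x x≉0) (trans (*-congʳ x≈y) (inverse y (λ y≈0 → x≉0 (trans x≈y y≈0))))

  ⁻¹-distrib-* : ∀ {x y} → x ≉ 0# → y ≉ 0# → (x * y) ⁻¹ ≈ x ⁻¹ * y ⁻¹
  ⁻¹-distrib-* {x} {y} x≉0 y≉0 = inverse-unique (inverse _ (*-≉0 x≉0 y≉0)) (begin
    x * y * (x ⁻¹ * y ⁻¹)     ≈⟨ interchange _ _ _ _ ⟩
    x * x ⁻¹ * (y * y ⁻¹)     ≈⟨ *-cong (inverse x x≉0) (inverse y y≉0) ⟩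
    1# * 1#                   ≈⟨ *-identityˡ 1# ⟩
    1#                        ∎)

  /-cong : ∀ {x x′ y y′} → y′ ≉ 0# → x ≈ x′ → y ≈ y′ → x / y ≈ x′ / y′
  /-cong y′≉0 x≈x′ y≈y′ = *-cong x≈x′ (sym (⁻¹-cong y′≉0 (sym y≈y′)))

  /-*-cancelʳ : ∀ {x y z} → y ≉ 0# → z ≉ 0# → (x * z) / (y * z) ≈ x / y
  /-*-cancelʳ {x} {y} {z} y≉0 z≉0 = begin
    (x * z) * (y * z) ⁻¹       ≈⟨ *-congˡ (⁻¹-distrib-* y≉0 z≉0) ⟩
    (x * z) * (y ⁻¹ * z ⁻¹)    ≈⟨ interchange _ _ _ _ ⟩
    (x * y ⁻¹) * (z * z ⁻¹)    ≈⟨ *-congˡ (inverse z z≉0) ⟩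
    (x * y ⁻¹) * 1#            ≈⟨ *-identityʳ _ ⟩
    x * y ⁻¹                   ∎

  -- Finite sums and products

  sumF-cong : ∀ n {f g : Fin n → Carrier} → (∀ i → f i ≈ g i) → sumF n f ≈ sumF n g
  sumF-cong zero    f≈g = refl
  sumF-cong (suc n) f≈g = +-cong (f≈g zero) (sumF-cong n (f≈g ∘ suc))

  sumF-zero : ∀ n {f : Fin n → Carrier} → (∀ i → f i ≈ 0#) → sumF n f ≈ 0#
  sumF-zero zero    f≈0 = refl
  sumF-zero (suc n) f≈0 = trans (+-cong (f≈0 zero) (sumF-zero n (f≈0 ∘ suc))) (+-identityˡ 0#)

  sumF-distrib-+ : ∀ n (f g : Fin n → Carrier) → sumF n (λ i → f i + g i) ≈ sumF n f + sumF n g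
  sumF-distrib-+ zero    f g = sym (+-identityˡ 0#)
  sumF-distrib-+ (suc n) f g = trans (+-congˡ (sumF-distrib-+ n _ _)) (+-interchange _ _ _ _)

  sumF-distribˡ-* : ∀ n a (f : Fin n → Carrier) → sumF n (λ i → a * f i) ≈ a * sumF n f
  sumF-distribˡ-* zero    a f = sym (zeroʳ a)
  sumF-distribˡ-* (suc n) a f = trans (+-congˡ (sumF-distribˡ-* n a _)) (sym (distribˡ _ _ _))

  sumF-neg : ∀ n (f : Fin n → Carrier) → sumF n (λ i → - f i) ≈ - sumF n f
  sumF-neg zero    f = sym ε⁻¹≈ε
  sumF-neg (suc n) f = trans (+-congˡ (sumF-neg n _)) (⁻¹-∙-comm _ _)

  sumF-last : ∀ n (f : Fin (suc n) → Carrier) → (∀ k → f (inject₁ k) ≈ 0#) → sumF (suc n) f ≈ f (fromℕ n)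
  sumF-last zero    f _      = +-identityʳ _
  sumF-last (suc n) f init≈0 =
    trans (+-cong (init≈0 zero) (sumF-last n (f ∘ suc) (init≈0 ∘ suc))) (+-identityˡ _)

  prodF-cong : ∀ n {f g : Fin n → Carrier} → (∀ i → f i ≈ g i) → prodF n f ≈ prodF n g
  prodF-cong zero    f≈g = refl
  prodF-cong (suc n) f≈g = *-cong (f≈g zero) (prodF-cong n (f≈g ∘ suc))

  prodF-one : ∀ n {f : Fin n → Carrier} → (∀ i → f i ≈ 1#) → prodF n f ≈ 1#
  prodF-one zero    f≈1 = refl
  prodF-one (suc n) f≈1 = trans (*-cong (f≈1 zero) (prodF-one n (f≈1 ∘ suc))) (*-identityˡ 1#)

  prodF-distrib-* : ∀ n (f g : Fin n → Carrier) → prodF n (λ i → f i * g i) ≈ prodF n f * prodF n g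
  prodF-distrib-* zero    f g = sym (*-identityˡ 1#)
  prodF-distrib-* (suc n) f g = trans (*-congˡ (prodF-distrib-* n _ _)) (interchange _ _ _ _)

  prodF-const : ∀ n a → prodF n (λ _ → a) ≈ a ^ n
  prodF-const zero    a = refl
  prodF-const (suc n) a = *-congˡ (prodF-const n a)

  prodF-neg : ∀ n (f : Fin n → Carrier) → prodF n (λ i → - f i) ≈ sign n * prodF n f
  prodF-neg zero    f = sym (*-identityˡ 1#)
  prodF-neg (suc n) f = begin
    - f zero * prodF n (λ i → - f (suc i))        ≈⟨ *-congˡ (prodF-neg n (f ∘ suc)) ⟩
    - f zero * (sign n * prodF n (f ∘ suc))       ≈⟨ solve 3 (λ a s p → :- a :* (s :* p) := :- s :* (a :* p)) refl _ _ _ ⟩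
    - sign n * (f zero * prodF n (f ∘ suc))       ∎

  prodF-last : ∀ n (f : Fin (suc n) → Carrier) → prodF (suc n) f ≈ prodF n (f ∘ inject₁) * f (fromℕ n)
  prodF-last zero    f = trans (*-identityʳ _) (sym (*-identityˡ _))
  prodF-last (suc n) f = trans (*-congˡ (prodF-last n (f ∘ suc))) (sym (*-assoc _ _ _))

  prodF-punchIn : ∀ n (f : Fin (suc n) → Carrier) j → prodF (suc n) f ≈ f j * prodF n (f ∘ punchIn j)
  prodF-punchIn n       f zero    = refl
  prodF-punchIn (suc n) f (suc j) =
    trans (*-congˡ (prodF-punchIn n (f ∘ suc) j)) (x∙yz≈y∙xz _ _ _)

  prodF-≉0 : ∀ n {f : Fin n → Carrier} → (∀ i → f i ≉ 0#) → prodF n f ≉ 0#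
  prodF-≉0 zero    f≉0 = 1≉0
  prodF-≉0 (suc n) f≉0 = *-≉0 (f≉0 zero) (prodF-≉0 n (f≉0 ∘ suc))

  ^-congˡ : ∀ m {x y} → x ≈ y → x ^ m ≈ y ^ m
  ^-congˡ zero    x≈y = refl
  ^-congˡ (suc m) x≈y = *-cong x≈y (^-congˡ m x≈y)

  ^-distribʳ-* : ∀ m x y → (x * y) ^ m ≈ x ^ m * y ^ m
  ^-distribʳ-* zero    x y = sym (*-identityˡ 1#)
  ^-distribʳ-* (suc m) x y = trans (*-congˡ (^-distribʳ-* m x y)) (interchange _ _ _ _)

  1^m≈1 : ∀ m → 1# ^ m ≈ 1#
  1^m≈1 zero    = refl
  1^m≈1 (suc m) = trans (*-identityˡ _) (1^m≈1 m)

  sign*sign≈1 : ∀ m → sign m * sign m ≈ 1#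
  sign*sign≈1 zero    = *-identityˡ 1#
  sign*sign≈1 (suc m) =
    trans (solve 1 (λ s → :- s :* :- s := s :* s) refl (sign m)) (sign*sign≈1 m)

  ^ℤ-suc : ∀ {x} → x ≉ 0# → ∀ z → x ^ℤ (+ 1 ℤ.+ z) ≈ x * x ^ℤ z
  ^ℤ-suc     x≉0 (+ m)        = refl
  ^ℤ-suc     x≉0 -[1+ zero ]  = sym (trans (*-congˡ (*-identityʳ _)) (inverse _ x≉0))
  ^ℤ-suc {x} x≉0 -[1+ suc m ] = sym (begin
    x * (x ⁻¹ * (x ⁻¹) ^ suc m) ≈⟨ *-assoc _ _ _ ⟨
    x * x ⁻¹ * (x ⁻¹) ^ suc m   ≈⟨ *-congʳ (inverse _ x≉0) ⟩
    1# * (x ⁻¹) ^ suc m         ≈⟨ *-identityˡ _ ⟩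
    (x ⁻¹) ^ suc m              ∎)

  ^ℤ-+ℕ : ∀ {x} → x ≉ 0# → ∀ z m → x ^ℤ (z ℤ.+ + m) ≈ x ^ℤ z * x ^ m
  ^ℤ-+ℕ {x} x≉0 z zero    = trans (reflexive (≡.cong (x ^ℤ_) (ℤₚ.+-identityʳ z))) (sym (*-identityʳ _))
  ^ℤ-+ℕ {x} x≉0 z (suc m) = begin
    x ^ℤ (z ℤ.+ + suc m)       ≡⟨ ≡.cong (x ^ℤ_) z+[1+m]≡1+[z+m] ⟩
    x ^ℤ (+ 1 ℤ.+ (z ℤ.+ + m)) ≈⟨ ^ℤ-suc x≉0 (z ℤ.+ + m) ⟩
    x * x ^ℤ (z ℤ.+ + m)       ≈⟨ *-congˡ (^ℤ-+ℕ x≉0 z m) ⟩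
    x * (x ^ℤ z * x ^ m)       ≈⟨ x∙yz≈y∙xz _ _ _ ⟩
    x ^ℤ z * (x * x ^ m)       ∎
    where
    z+[1+m]≡1+[z+m] : z ℤ.+ + suc m ≡ + 1 ℤ.+ (z ℤ.+ + m)
    z+[1+m]≡1+[z+m] = ≡.trans (≡.sym (ℤₚ.+-assoc z (+ 1) (+ m)))
      (≡.trans (≡.cong (ℤ._+ + m) (ℤₚ.+-comm z (+ 1))) (ℤₚ.+-assoc (+ 1) z (+ m)))

  -- Determinants

  Matrix : ℕ → Set c
  Matrix n = Fin n → Fin n → Carrier

  minor : ∀ {n} → Matrix (suc n) → Fin (suc n) → Matrix n
  minor A j r k = A (suc r) (punchIn j k)

  laplaceTerm : ∀ {n} → Matrix (suc n) → Fin (suc n) → Carrier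
  laplaceTerm {n} A j = sign (toℕ j) * (A zero j * det n (minor A j))

  laplaceTerm-≈0 : ∀ {n} (A : Matrix (suc n)) j → det n (minor A j) ≈ 0# → laplaceTerm A j ≈ 0#
  laplaceTerm-≈0 A j d≈0 = trans (*-congˡ (trans (*-congˡ d≈0) (zeroʳ _))) (zeroʳ _)

  det-cong : ∀ n {A B : Matrix n} → (∀ i j → A i j ≈ B i j) → det n A ≈ det n B
  det-cong zero    A≈B = refl
  det-cong (suc n) A≈B = sumF-cong (suc n) λ j →
    *-congˡ {sign (toℕ j)} (*-cong (A≈B zero j) (det-cong n λ r k → A≈B (suc r) (punchIn j k)))

  det-zero-column : ∀ n (A : Matrix n) c → (∀ i → A i c ≈ 0#) → det n A ≈ 0#
  det-zero-column (suc n) A c Ac≈0 = sumF-zero (suc n) term≈0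
    where
    term≈0 : ∀ j → laplaceTerm A j ≈ 0#
    term≈0 j with j Finₚ.≟ c
    ... | yes ≡.refl = trans (*-congˡ (trans (*-congʳ (Ac≈0 zero)) (zeroˡ _))) (zeroʳ _)
    ... | no j≢c     = laplaceTerm-≈0 A j (det-zero-column n (minor A j) (punchOut j≢c) λ r →
          trans (reflexive (≡.cong (A (suc r)) (Finₚ.punchIn-punchOut j≢c))) (Ac≈0 (suc r)))

  det-scale-columns : ∀ n (s : Fin n → Carrier) (A : Matrix n) →
    det n (λ i j → s j * A i j) ≈ prodF n s * det n A
  det-scale-columns zero    s A = sym (*-identityˡ 1#)
  det-scale-columns (suc n) s A = begin
    sumF (suc n) (λ j → sign (toℕ j) * ((s j * A zero j) * det n (λ r k → s (punchIn j k) * minor A j r k)))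
      ≈⟨ sumF-cong (suc n) term ⟩
    sumF (suc n) (λ j → prodF (suc n) s * laplaceTerm A j)
      ≈⟨ sumF-distribˡ-* (suc n) (prodF (suc n) s) (laplaceTerm A) ⟩
    prodF (suc n) s * det (suc n) A ∎
    where
    term : ∀ j → sign (toℕ j) * ((s j * A zero j) * det n (λ r k → s (punchIn j k) * minor A j r k))
                 ≈ prodF (suc n) s * laplaceTerm A j
    term j = begin
      sign (toℕ j) * ((s j * A zero j) * det n (λ r k → s (punchIn j k) * minor A j r k))
        ≈⟨ *-congˡ (*-congˡ (det-scale-columns n (s ∘ punchIn j) (minor A j))) ⟩
      sign (toℕ j) * ((s j * A zero j) * (prodF n (s ∘ punchIn j) * det n (minor A j)))
        ≈⟨ solve 5 (λ σ x a p d → σ :* ((x :* a) :* (p :* d)) := (x :* p) :* (σ :* (a :* d))) refl _ _ _ _ _ ⟩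
      (s j * prodF n (s ∘ punchIn j)) * laplaceTerm A j
        ≈⟨ *-congʳ (prodF-punchIn n s j) ⟨
      prodF (suc n) s * laplaceTerm A j ∎

  det-last-column : ∀ n (A : Matrix (suc n)) → (∀ r → A (suc r) (fromℕ n) ≈ 0#) →
    det (suc n) A ≈ sign n * (A zero (fromℕ n) * det n (λ r k → A (suc r) (inject₁ k)))
  det-last-column n A last≈0 = begin
    det (suc n) A              ≈⟨ sumF-last n (laplaceTerm A) init≈0 ⟩
    laplaceTerm A (fromℕ n)    ≈⟨ *-cong (reflexive (≡.cong sign (Finₚ.toℕ-fromℕ n)))
                                    (*-congˡ (det-cong n λ r k → reflexive (≡.cong (A (suc r)) (punchIn-fromℕ n k)))) ⟩
    sign n * (A zero (fromℕ n) * det n (λ r k → A (suc r) (inject₁ k))) ∎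
    where
    punchIn-fromℕ : ∀ n (k : Fin n) → punchIn (fromℕ n) k ≡ inject₁ k
    punchIn-fromℕ (suc n) zero    = ≡.refl
    punchIn-fromℕ (suc n) (suc k) = ≡.cong suc (punchIn-fromℕ n k)
    init≈0 : ∀ k → laplaceTerm A (inject₁ k) ≈ 0#
    init≈0 k = laplaceTerm-≈0 A (inject₁ k) (det-zero-column n (minor A (inject₁ k)) (punchOut k≢n) λ r →
      trans (reflexive (≡.cong (A (suc r)) (Finₚ.punchIn-punchOut k≢n))) (last≈0 r))
      where
      k≢n : inject₁ k ≢ fromℕ n
      k≢n = Finₚ.fromℕ≢inject₁ ∘ ≡.sym

  det-linear-row : ∀ n (k : Fin n) t (A B C : Matrix n) →
    (∀ i → i ≢ k → ∀ j → A i j ≈ B i j) → (∀ i → i ≢ k → ∀ j → C i j ≈ B i j) →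
    (∀ j → A k j ≈ B k j + t * C k j) → det n A ≈ det n B + t * det n C
  det-linear-row (suc n) k t A B C A≈B C≈B Ak≈ = begin
    det (suc n) A                                                     ≈⟨ sumF-cong (suc n) (term k A≈B C≈B Ak≈) ⟩
    sumF (suc n) (λ j → laplaceTerm B j + t * laplaceTerm C j)        ≈⟨ sumF-distrib-+ (suc n) (laplaceTerm B) (λ j → t * laplaceTerm C j) ⟩
    det (suc n) B + sumF (suc n) (λ j → t * laplaceTerm C j)          ≈⟨ +-congˡ (sumF-distribˡ-* (suc n) t (laplaceTerm C)) ⟩
    det (suc n) B + t * det (suc n) C                                 ∎
    where
    term : ∀ k → (∀ i → i ≢ k → ∀ j → A i j ≈ B i j) → (∀ i → i ≢ k → ∀ j → C i j ≈ B i j) →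
           (∀ j → A k j ≈ B k j + t * C k j) → ∀ j → laplaceTerm A j ≈ laplaceTerm B j + t * laplaceTerm C j
    term zero A≈B C≈B A₀≈ j = begin
      sign (toℕ j) * (A zero j * det n (minor A j))
        ≈⟨ *-congˡ (*-cong (A₀≈ j) (det-cong n λ r l → A≈B (suc r) (λ ()) _)) ⟩
      sign (toℕ j) * ((B zero j + t * C zero j) * det n (minor B j))
        ≈⟨ solve 5 (λ σ b t c d → σ :* ((b :+ t :* c) :* d) := σ :* (b :* d) :+ t :* (σ :* (c :* d))) refl _ _ _ _ _ ⟩
      laplaceTerm B j + t * (sign (toℕ j) * (C zero j * det n (minor B j)))
        ≈⟨ +-congˡ (*-congˡ (*-congˡ (*-congˡ (det-cong n λ r l → sym (C≈B (suc r) (λ ()) _))))) ⟩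
      laplaceTerm B j + t * laplaceTerm C j ∎
    term (suc k) A≈B C≈B Ak≈ j = begin
      sign (toℕ j) * (A zero j * det n (minor A j))
        ≈⟨ *-congˡ (*-cong (A≈B zero (λ ()) j) (det-linear-row n k t _ _ _
              (λ r r≢k l → A≈B (suc r) (r≢k ∘ Finₚ.suc-injective) _)
              (λ r r≢k l → C≈B (suc r) (r≢k ∘ Finₚ.suc-injective) _)
              (λ l → Ak≈ _))) ⟩
      sign (toℕ j) * (B zero j * (det n (minor B j) + t * det n (minor C j)))
        ≈⟨ solve 5 (λ σ b d t e → σ :* (b :* (d :+ t :* e)) := σ :* (b :* d) :+ t :* (σ :* (b :* e))) refl _ _ _ _ _ ⟩
      laplaceTerm B j + t * (sign (toℕ j) * (B zero j * det n (minor C j)))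
        ≈⟨ +-congˡ (*-congˡ (*-congˡ (*-congʳ (sym (C≈B zero (λ ()) j))))) ⟩
      laplaceTerm B j + t * laplaceTerm C j ∎

  -- det (2 + m) A unfolds definitionally to twoRowExpansion m (A 0) (A 1) G, where G σ is the
  -- determinant of the remaining rows restricted to the columns σ.
  twoRowExpansion : ∀ m → (a b : Fin (suc (suc m)) → Carrier) → ((Fin m → Fin (suc (suc m))) → Carrier) → Carrier
  twoRowExpansion m a b G = sumF (suc (suc m)) λ j → sign (toℕ j) * (a j *
    sumF (suc m) λ k → sign (toℕ k) * (b (punchIn j k) * G (punchIn j ∘ punchIn k)))

  columnZeroDeleted : ∀ m → (Fin (suc (suc m)) → Carrier) → ((Fin m → Fin (suc (suc m))) → Carrier) → Carrier
  columnZeroDeleted m a G = sumF (suc m) λ k → sign (toℕ k) * (a (suc k) * G (suc ∘ punchIn k))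

  columnZeroDeleted-cong : ∀ m {a b} G → (∀ j → a j ≈ b j) → columnZeroDeleted m a G ≈ columnZeroDeleted m b G
  columnZeroDeleted-cong m G a≈b = sumF-cong (suc m) λ k → *-congˡ {sign (toℕ k)} (*-congʳ {G (suc ∘ punchIn k)} (a≈b (suc k)))

  Respects≗ : ∀ {m M} → ((Fin m → Fin M) → Carrier) → Set ℓ
  Respects≗ G = ∀ {σ τ} → σ ≗ τ → G σ ≈ G τ

  twoRowExpansion-term-suc : ∀ m (a b : Fin (3 ℕ.+ m) → Carrier) (G : (Fin (suc m) → Fin (3 ℕ.+ m)) → Carrier) →
    Respects≗ G → ∀ j →
    sign (toℕ (suc j)) * (a (suc j) *
      sumF (suc (suc m)) λ k → sign (toℕ k) * (b (punchIn (suc j) k) * G (punchIn (suc j) ∘ punchIn k)))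
    ≈ - (b zero * (sign (toℕ j) * (a (suc j) * G (suc ∘ punchIn j))))
      + sign (toℕ j) * (a (suc j) *
          sumF (suc m) λ k → sign (toℕ k) * (b (suc (punchIn j k)) * G (lift 1 (punchIn j ∘ punchIn k))))
  twoRowExpansion-term-suc m a b G G-resp j = begin
    - σ * (x * (1# * (b zero * h) + sumF (suc m) λ k →
        - sign (toℕ k) * (b (suc (punchIn j k)) * G (punchIn (suc j) ∘ punchIn (suc k)))))
      ≈⟨ *-congˡ (*-congˡ (+-congˡ tail≈)) ⟩
    - σ * (x * (1# * (b zero * h) - X))
      ≈⟨ solve 5 (λ σ x b h y → :- σ :* (x :* (con (+ 1) :* (b :* h) :- y)) := :- (b :* (σ :* (x :* h))) :+ σ :* (x :* y))
           refl σ x (b zero) h X ⟩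
    - (b zero * (σ * (x * h))) + σ * (x * X) ∎
    where
    σ x h : Carrier
    σ = sign (toℕ j)
    x = a (suc j)
    h = G (suc ∘ punchIn j)
    term : Fin (suc m) → Carrier
    term k = sign (toℕ k) * (b (suc (punchIn j k)) * G (lift 1 (punchIn j ∘ punchIn k)))
    X : Carrier
    X = sumF (suc m) term
    tail≈ : sumF (suc m) (λ k → - sign (toℕ k) * (b (suc (punchIn j k)) * G (punchIn (suc j) ∘ punchIn (suc k))))
            ≈ - X
    tail≈ = trans (sumF-cong (suc m) {g = λ k → - term k} λ k → trans (sym (-‿distribˡ-* _ _))
              (-‿cong (*-congˡ (*-congˡ (G-resp {punchIn (suc j) ∘ punchIn (suc k)} {lift 1 (punchIn j ∘ punchIn k)}
                λ { zero → ≡.refl ; (suc y) → ≡.refl })))))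
            (sumF-neg (suc m) term)

  -- Splitting off column 0 pairs the terms containing a₀ with those containing b₀; what remains
  -- is the same expansion for the matrix without column 0.
  twoRowExpansion-suc : ∀ m a b G → Respects≗ G →
    twoRowExpansion (suc m) a b G
      ≈ (a zero * columnZeroDeleted (suc m) b G - b zero * columnZeroDeleted (suc m) a G)
        + twoRowExpansion m (a ∘ suc) (b ∘ suc) (G ∘ lift 1)
  twoRowExpansion-suc m a b G G-resp = begin
    1# * (a zero * Sb) + sumF (suc (suc m)) (λ j → - sign (toℕ j) * (a (suc j) * inner j))
      ≈⟨ +-congˡ (sumF-cong (suc (suc m)) (twoRowExpansion-term-suc m a b G G-resp)) ⟩
    1# * (a zero * Sb) + sumF (suc (suc m)) (λ j → - (b zero * Ha j) + rest j)
      ≈⟨ +-congˡ (sumF-distrib-+ (suc (suc m)) (λ j → - (b zero * Ha j)) rest) ⟩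
    1# * (a zero * Sb) + (sumF (suc (suc m)) (λ j → - (b zero * Ha j)) + R)
      ≈⟨ +-congˡ (+-congʳ (trans (sumF-neg (suc (suc m)) (λ j → b zero * Ha j))
                                 (-‿cong (sumF-distribˡ-* (suc (suc m)) (b zero) Ha)))) ⟩
    1# * (a zero * Sb) + (- (b zero * Sa) + R)
      ≈⟨ solve 3 (λ x y z → con (+ 1) :* x :+ (:- y :+ z) := (x :- y) :+ z) refl _ _ _ ⟩
    (a zero * Sb - b zero * Sa) + R ∎
    where
    Sa Sb R : Carrier
    Sa = columnZeroDeleted (suc m) a G
    Sb = columnZeroDeleted (suc m) b G
    R  = twoRowExpansion m (a ∘ suc) (b ∘ suc) (G ∘ lift 1)
    Ha inner rest : Fin (suc (suc m)) → Carrier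
    Ha j = sign (toℕ j) * (a (suc j) * G (suc ∘ punchIn j))
    inner j = sumF (suc (suc m)) λ k → sign (toℕ k) * (b (punchIn (suc j) k) * G (punchIn (suc j) ∘ punchIn k))
    rest j = sign (toℕ j) * (a (suc j) * sumF (suc m) λ k →
      sign (toℕ k) * (b (suc (punchIn j k)) * G (lift 1 (punchIn j ∘ punchIn k))))

  twoRowExpansion-≈0 : ∀ m a b G → Respects≗ G → (∀ j → b j ≈ a j) → twoRowExpansion m a b G ≈ 0#
  twoRowExpansion-≈0 zero a b G G-resp b≈a = begin
    1# * (a zero * (1# * (b (suc zero) * G σ₀) + 0#)) + (- 1# * (a (suc zero) * (1# * (b zero * G σ₁) + 0#)) + 0#)
      ≈⟨ +-cong (*-congˡ (*-congˡ (+-congʳ (*-congˡ (*-cong (b≈a _) (G-resp λ ()))))))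
                (+-congʳ (*-congˡ (*-congˡ (+-congʳ (*-congˡ (*-congʳ (b≈a _))))))) ⟩
    1# * (a zero * (1# * (a (suc zero) * G σ₁) + 0#)) + (- 1# * (a (suc zero) * (1# * (a zero * G σ₁) + 0#)) + 0#)
      ≈⟨ solve 3 (λ x y g → con (+ 1) :* (x :* (con (+ 1) :* (y :* g) :+ con (+ 0)))
                            :+ (:- con (+ 1) :* (y :* (con (+ 1) :* (x :* g) :+ con (+ 0))) :+ con (+ 0)) := con (+ 0))
           refl _ _ _ ⟩
    0# ∎
    where
    σ₀ σ₁ : Fin 0 → Fin 2
    σ₀ = punchIn zero ∘ punchIn zero
    σ₁ = punchIn (suc zero) ∘ punchIn zero
  twoRowExpansion-≈0 (suc m) a b G G-resp b≈a = begin
    twoRowExpansion (suc m) a b G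
      ≈⟨ twoRowExpansion-suc m a b G G-resp ⟩
    (a zero * columnZeroDeleted (suc m) b G - b zero * columnZeroDeleted (suc m) a G)
      + twoRowExpansion m (a ∘ suc) (b ∘ suc) (G ∘ lift 1)
      ≈⟨ +-cong (+-cong (*-congˡ (columnZeroDeleted-cong (suc m) G b≈a)) (-‿cong (*-congʳ (b≈a zero))))
                (twoRowExpansion-≈0 m (a ∘ suc) (b ∘ suc) (G ∘ lift 1) (λ σ≗τ → G-resp (lift-cong σ≗τ)) (b≈a ∘ suc)) ⟩
    (a zero * columnZeroDeleted (suc m) a G - a zero * columnZeroDeleted (suc m) a G) + 0#
      ≈⟨ trans (+-identityʳ _) (-‿inverseʳ _) ⟩
    0# ∎
    where
    lift-cong : ∀ {k} {σ τ : Fin k → Fin (suc (suc m))} → σ ≗ τ → lift 1 σ ≗ lift 1 τ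
    lift-cong σ≗τ zero    = ≡.refl
    lift-cong σ≗τ (suc y) = ≡.cong suc (σ≗τ y)

  det-adjacent-rows : ∀ n (k : Fin n) (A : Matrix (suc n)) →
    (∀ j → A (suc k) j ≈ A (inject₁ k) j) → det (suc n) A ≈ 0#
  det-adjacent-rows (suc m) zero    A A₁≈A₀ =
    twoRowExpansion-≈0 m (A zero) (A (suc zero)) (λ σ → det m λ r l → A (suc (suc r)) (σ l))
      (λ σ≗τ → det-cong m λ r l → reflexive (≡.cong (A (suc (suc r))) (σ≗τ l))) A₁≈A₀
  det-adjacent-rows (suc m) (suc k) A Ak≈ = sumF-zero (suc (suc m)) λ j →
    laplaceTerm-≈0 A j (det-adjacent-rows m k (minor A j) (Ak≈ ∘ punchIn j))

  det-row-operation : ∀ n (k : Fin n) t (A B : Matrix (suc n)) →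
    (∀ i → i ≢ suc k → ∀ j → A i j ≈ B i j) →
    (∀ j → A (suc k) j ≈ B (suc k) j - t * B (inject₁ k) j) → det (suc n) A ≈ det (suc n) B
  det-row-operation n k t A B A≈B Ak≈ = begin
    det (suc n) A                        ≈⟨ det-linear-row (suc n) (suc k) (- t) A B C A≈B C≈B Ak≈′ ⟩
    det (suc n) B + - t * det (suc n) C  ≈⟨ +-congˡ (trans (*-congˡ (det-adjacent-rows n k C C-adjacent)) (zeroʳ _)) ⟩
    det (suc n) B + 0#                   ≈⟨ +-identityʳ _ ⟩
    det (suc n) B                        ∎
    where
    C : Matrix (suc n)
    C = updateAt B (suc k) (λ _ → B (inject₁ k))
    C≈B : ∀ i → i ≢ suc k → ∀ j → C i j ≈ B i j
    C≈B i i≢k+1 j = reflexive (≡.cong (λ row → row j) (updateAt-minimal i (suc k) B i≢k+1))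
    C₍k+1₎ : ∀ j → C (suc k) j ≡ B (inject₁ k) j
    C₍k+1₎ j = ≡.cong (λ row → row j) (updateAt-updates (suc k) B)
    k≢k+1 : inject₁ k ≢ suc k
    k≢k+1 k≡k+1 = ℕₚ.1+n≢n (≡.trans (≡.cong toℕ (≡.sym k≡k+1)) (Finₚ.toℕ-inject₁ k))
    C-adjacent : ∀ j → C (suc k) j ≈ C (inject₁ k) j
    C-adjacent j = trans (reflexive (C₍k+1₎ j)) (sym (C≈B (inject₁ k) k≢k+1 j))
    Ak≈′ : ∀ j → A (suc k) j ≈ B (suc k) j + - t * C (suc k) j
    Ak≈′ j = trans (Ak≈ j) (+-congˡ (trans (-‿distribˡ-* t _) (*-congˡ (reflexive (≡.sym (C₍k+1₎ j))))))

  subtractPreviousRows : ∀ {n} → Carrier → Matrix (suc n) → Matrix (suc n)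
  subtractPreviousRows t A zero    j = A zero j
  subtractPreviousRows t A (suc r) j = A (suc r) j - t * A (inject₁ r) j

  reducedBelow : ∀ {n} → Carrier → Matrix (suc n) → ℕ → Matrix (suc n)
  reducedBelow t A k i with toℕ i ℕ.≤? k
  ... | yes _ = A i
  ... | no  _ = subtractPreviousRows t A i

  reducedBelow-≤ : ∀ {n} t (A : Matrix (suc n)) {k i} → toℕ i ≤ k → reducedBelow t A k i ≡ A i
  reducedBelow-≤ t A {k} {i} i≤k with toℕ i ℕ.≤? k
  ... | yes _   = ≡.refl
  ... | no  i≰k = ⊥-elim (i≰k i≤k)

  reducedBelow-≰ : ∀ {n} t (A : Matrix (suc n)) {k i} → ¬ toℕ i ≤ k →
    reducedBelow t A k i ≡ subtractPreviousRows t A i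
  reducedBelow-≰ t A {k} {i} i≰k with toℕ i ℕ.≤? k
  ... | yes i≤k = ⊥-elim (i≰k i≤k)
  ... | no  _   = ≡.refl

  -- A single row operation, since row k is still the original one.
  det-reducedBelow-suc : ∀ n t (A : Matrix (suc n)) k → k ℕ.< n →
    det (suc n) (reducedBelow t A k) ≈ det (suc n) (reducedBelow t A (suc k))
  det-reducedBelow-suc n t A k k<n =
    det-row-operation n r t (reducedBelow t A k) (reducedBelow t A (suc k)) unchanged step
    where
    r : Fin n
    r = fromℕ< k<n
    r≡k : toℕ r ≡ k
    r≡k = Finₚ.toℕ-fromℕ< k<n
    unchanged : ∀ i → i ≢ suc r → ∀ j → reducedBelow t A k i j ≈ reducedBelow t A (suc k) i j
    unchanged i i≢r+1 j with toℕ i ℕ.≤? k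
    ... | yes i≤k = reflexive (≡.cong (λ row → row j) (≡.sym (reducedBelow-≤ t A (ℕₚ.m≤n⇒m≤1+n i≤k))))
    ... | no  i≰k = reflexive (≡.cong (λ row → row j) (≡.sym (reducedBelow-≰ t A λ i≤k+1 →
            i≢r+1 (Finₚ.toℕ-injective (≡.trans (ℕₚ.≤-antisym i≤k+1 (ℕₚ.≰⇒> i≰k)) (≡.cong suc (≡.sym r≡k)))))))
    step : ∀ j → reducedBelow t A k (suc r) j
                 ≈ reducedBelow t A (suc k) (suc r) j - t * reducedBelow t A (suc k) (inject₁ r) j
    step j = begin
      reducedBelow t A k (suc r) j       ≡⟨ ≡.cong (λ row → row j) (reducedBelow-≰ t A (ℕₚ.<-irrefl r≡k)) ⟩
      A (suc r) j - t * A (inject₁ r) j  ≡⟨ ≡.cong₂ (λ row row′ → row j - t * row′ j)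
           (≡.sym (reducedBelow-≤ t A (ℕₚ.≤-reflexive (≡.cong suc r≡k))))
           (≡.sym (reducedBelow-≤ t A (ℕₚ.≤-trans (ℕₚ.≤-reflexive (≡.trans (Finₚ.toℕ-inject₁ r) r≡k)) (ℕₚ.n≤1+n k)))) ⟩
      reducedBelow t A (suc k) (suc r) j - t * reducedBelow t A (suc k) (inject₁ r) j ∎

  det-reducedBelow : ∀ n t (A : Matrix (suc n)) k → k ≤ n →
    det (suc n) (reducedBelow t A 0) ≈ det (suc n) (reducedBelow t A k)
  det-reducedBelow n t A zero    _   = refl
  det-reducedBelow n t A (suc k) k<n =
    trans (det-reducedBelow n t A k (ℕₚ.<⇒≤ k<n)) (det-reducedBelow-suc n t A k k<n)

  det-subtractPreviousRows : ∀ n t (A : Matrix (suc n)) → det (suc n) (subtractPreviousRows t A) ≈ det (suc n) A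
  det-subtractPreviousRows n t A = begin
    det (suc n) (subtractPreviousRows t A) ≈⟨ det-cong (suc n) (λ i j → reflexive (≡.cong (λ row → row j) (row₀ i))) ⟨
    det (suc n) (reducedBelow t A 0)       ≈⟨ det-reducedBelow n t A n ℕₚ.≤-refl ⟩
    det (suc n) (reducedBelow t A n)       ≈⟨ det-cong (suc n) (λ i j → reflexive (≡.cong (λ row → row j)
                                                (reducedBelow-≤ t A (ℕₚ.≤-pred (Finₚ.toℕ<n i))))) ⟩
    det (suc n) A                          ∎
    where
    row₀ : ∀ i → reducedBelow t A 0 i ≡ subtractPreviousRows t A i
    row₀ zero    = reducedBelow-≤ t A {0} {zero} ℕ.z≤n
    row₀ (suc r) = reducedBelow-≰ t A {0} {suc r} λ ()

  -- The Vandermonde product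

  snoc-inject₁ : ∀ n (f : Fin n → Carrier) y k → snoc n f y (inject₁ k) ≡ f k
  snoc-inject₁ (suc n) f y zero    = ≡.refl
  snoc-inject₁ (suc n) f y (suc k) = snoc-inject₁ n (f ∘ suc) y k

  snoc-last : ∀ n (f : Fin n → Carrier) y → snoc n f y (fromℕ n) ≡ y
  snoc-last zero    f y = ≡.refl
  snoc-last (suc n) f y = snoc-last n (f ∘ suc) y

  prodF-snoc : ∀ n (g : Carrier → Carrier) (f : Fin n → Carrier) y →
    prodF (suc n) (λ l → g (snoc n f y l)) ≈ prodF n (g ∘ f) * g y
  prodF-snoc n g f y = trans (prodF-last n (g ∘ snoc n f y))
    (*-cong (prodF-cong n λ k → reflexive (≡.cong g (snoc-inject₁ n f y k))) (reflexive (≡.cong g (snoc-last n f y))))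

  ifLess : ℕ → ℕ → Carrier → Carrier
  ifLess a b x = if does (a ℕ.<? b) then x else 1#

  ifLess-< : ∀ {a b} x → a ℕ.< b → ifLess a b x ≡ x
  ifLess-< x a<b = ≡.cong (λ c → if c then x else 1#) (dec-true (_ ℕ.<? _) a<b)

  ifLess-≮ : ∀ {a b} x → ¬ a ℕ.< b → ifLess a b x ≡ 1#
  ifLess-≮ x a≮b = ≡.cong (λ c → if c then x else 1#) (dec-false (_ ℕ.<? _) a≮b)

  vandermonde-snoc : ∀ n (v : Fin n → Carrier) y →
    vandermonde (suc n) (snoc n v y) ≈ vandermonde n v * prodF n (λ k → v k - y)
  vandermonde-snoc n v y = begin
    vandermonde (suc n) w                                        ≈⟨ prodF-last n row ⟩
    prodF n (row ∘ inject₁) * row (fromℕ n)                      ≈⟨ *-cong (prodF-cong n row-inject₁) row-last ⟩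
    prodF n (λ i → prodF n (λ j → ifLess (toℕ i) (toℕ j) (v i - v j)) * (v i - y)) * 1#
                                                                 ≈⟨ *-identityʳ _ ⟩
    prodF n (λ i → prodF n (λ j → ifLess (toℕ i) (toℕ j) (v i - v j)) * (v i - y))
                                                                 ≈⟨ prodF-distrib-* n _ _ ⟩
    vandermonde n v * prodF n (λ k → v k - y)                    ∎
    where
    w : Fin (suc n) → Carrier
    w = snoc n v y
    factor : Fin (suc n) → Fin (suc n) → Carrier
    factor i j = ifLess (toℕ i) (toℕ j) (w i - w j)
    row : Fin (suc n) → Carrier
    row i = prodF (suc n) (factor i)
    row-last : row (fromℕ n) ≈ 1#
    row-last = prodF-one (suc n) λ j → reflexive (ifLess-≮ (w (fromℕ n) - w j) λ n<j →
      ℕₚ.<-irrefl ≡.refl (ℕₚ.<-≤-trans (≡.subst (ℕ._< toℕ j) (Finₚ.toℕ-fromℕ n) n<j) (ℕₚ.≤-pred (Finₚ.toℕ<n j))))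
    factor-inject₁ : ∀ i j → factor (inject₁ i) (inject₁ j) ≡ ifLess (toℕ i) (toℕ j) (v i - v j)
    factor-inject₁ i j = ≡.trans
      (≡.cong₂ (λ a b → ifLess a b (w (inject₁ i) - w (inject₁ j))) (Finₚ.toℕ-inject₁ i) (Finₚ.toℕ-inject₁ j))
      (≡.cong₂ (λ a b → ifLess (toℕ i) (toℕ j) (a - b)) (snoc-inject₁ n v y i) (snoc-inject₁ n v y j))
    factor-last : ∀ i → factor (inject₁ i) (fromℕ n) ≡ v i - y
    factor-last i = ≡.trans
      (ifLess-< (w (inject₁ i) - w (fromℕ n))
        (≡.subst₂ ℕ._<_ (≡.sym (Finₚ.toℕ-inject₁ i)) (≡.sym (Finₚ.toℕ-fromℕ n)) (Finₚ.toℕ<n i)))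
      (≡.cong₂ _-_ (snoc-inject₁ n v y i) (snoc-last n v y))
    row-inject₁ : ∀ i → row (inject₁ i) ≈ prodF n (λ j → ifLess (toℕ i) (toℕ j) (v i - v j)) * (v i - y)
    row-inject₁ i = trans (prodF-last n (factor (inject₁ i)))
      (*-cong (prodF-cong n λ j → reflexive (factor-inject₁ i j)) (reflexive (factor-last i)))

  vandermonde-≉0 : ∀ n (v : Fin n → Carrier) → (∀ i j → i ≢ j → v i ≉ v j) → vandermonde n v ≉ 0#
  vandermonde-≉0 n v v-injective = prodF-≉0 n λ i → prodF-≉0 n λ j → factor≉0 i j
    where
    factor≉0 : ∀ i j → ifLess (toℕ i) (toℕ j) (v i - v j) ≉ 0#
    factor≉0 i j with toℕ i ℕ.<? toℕ j
    ... | yes i<j = ≡.subst (_≉ 0#) (≡.sym (ifLess-< _ i<j))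
                      (x≉y⇒x-y≉0 (v-injective i j λ i≡j → ℕₚ.<-irrefl (≡.cong toℕ i≡j) i<j))
    ... | no  i≮j = ≡.subst (_≉ 0#) (≡.sym (ifLess-≮ _ i≮j)) 1≉0

  -- From N - 1 to N variables

  module MhatRecursion (n : ℕ) (q γ s₀ ξ₀ : Carrier) (u v : Fin n → Carrier) (vN : Carrier)
                       (ξ₀≉0 : ξ₀ ≉ 0#) (vN≉0 : vN ≉ 0#) where

    u′ w : Fin (suc n) → Carrier
    u′ = snoc n u (vN ⁻¹)
    w  = snoc n v vN

    Bˡ Bʳ Cˡ Cʳ : Carrier → Carrier
    Bˡ x = 1# - γ * s₀ * (ξ₀ ⁻¹) * x
    Bʳ x = x * (ξ₀ ⁻¹) - γ * s₀
    Cˡ x = 1# - s₀ * (ξ₀ ⁻¹) * x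
    Cʳ x = q * x * (ξ₀ ⁻¹) - s₀

    -- Mhat m q γ s₀ ξ₀ z i x unfolds definitionally to
    -- ℳ (ξ₀ ^ℤ ξexp m (toℕ i)) (x ^ℤ vexp m (toℕ i)) (q ^ (m ∸ suc (toℕ i))) (P₁ m z x) (P₀ m z x) x.
    ℳ : (ξᵉ xᵉ qᵉ p₁ p₀ x : Carrier) → Carrier
    ℳ ξᵉ xᵉ qᵉ p₁ p₀ x = ξᵉ * (xᵉ * (Bˡ x * Bʳ x * p₁ - γ * qᵉ * Cˡ x * Cʳ x * p₀))

    ℳ-cong : ∀ x {a a′ b b′ c c′ d d′ e e′} → a ≈ a′ → b ≈ b′ → c ≈ c′ → d ≈ d′ → e ≈ e′ →
             ℳ a b c d e x ≈ ℳ a′ b′ c′ d′ e′ x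
    ℳ-cong x a≈ b≈ c≈ d≈ e≈ =
      *-cong a≈ (*-cong b≈ (+-cong (*-congˡ d≈) (-‿cong (*-cong (*-congʳ (*-congʳ (*-congˡ c≈))) e≈))))

    P₁ P₀ : ∀ m → (Fin m → Carrier) → Carrier → Carrier
    P₁ m z x = prodF m (λ l → 1# - q * x * z l)
    P₀ m z x = prodF m (λ l → 1# - x * z l)

    P₁-snoc : ∀ x → P₁ (suc n) u′ x ≈ P₁ n u x * (1# - q * x * vN ⁻¹)
    P₁-snoc x = prodF-snoc n (λ y → 1# - q * x * y) u (vN ⁻¹)

    P₀-snoc : ∀ x → P₀ (suc n) u′ x ≈ P₀ n u x * (1# - x * vN ⁻¹)
    P₀-snoc x = prodF-snoc n (λ y → 1# - x * y) u (vN ⁻¹)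

    t : Carrier
    t = ξ₀ * ξ₀ * vN ⁻¹

    columnFactor : Carrier → Carrier
    columnFactor x = ξ₀ * ((1# - x * vN ⁻¹) * (1# - q * x * vN ⁻¹))

    Mhat-step : ∀ r x → x ≉ 0# →
      Mhat (suc n) q γ s₀ ξ₀ u′ (suc r) x - t * Mhat (suc n) q γ s₀ ξ₀ u′ (inject₁ r) x
        ≈ columnFactor x * Mhat n q γ s₀ ξ₀ u r x
    Mhat-step r x x≉0 = begin
      Mhat (suc n) q γ s₀ ξ₀ u′ (suc r) x - t * Mhat (suc n) q γ s₀ ξ₀ u′ (inject₁ r) x
        ≈⟨ +-cong rowBelow (-‿cong (*-congˡ rowAbove)) ⟩
      ℳ (Z * ξ₀ ^ 2) Y Q (p₁ * a₁) (p₀ * a₀) x - t * ℳ Z (Y * x ^ 1) (q * Q) (p₁ * a₁) (p₀ * a₀) x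
        ≈⟨ identity Z Y Q p₁ p₀ x (vN ⁻¹) q ξ₀ γ (Bˡ x) (Bʳ x) (Cˡ x) (Cʳ x) ⟩
      columnFactor x * ℳ (Z * ξ₀ ^ 1) Y Q p₁ p₀ x
        ≈⟨ *-congˡ smallerRow ⟨
      columnFactor x * Mhat n q γ s₀ ξ₀ u r x ∎
      where
      k : ℕ
      k = toℕ r
      Z Y Q p₁ p₀ a₁ a₀ : Carrier
      Z = ξ₀ ^ℤ ξexp (suc n) k
      Y = x ^ℤ vexp n k
      Q = q ^ (n ℕ.∸ suc k)
      p₁ = P₁ n u x
      p₀ = P₀ n u x
      a₁ = 1# - q * x * vN ⁻¹
      a₀ = 1# - x * vN ⁻¹
      rowBelow : Mhat (suc n) q γ s₀ ξ₀ u′ (suc r) x ≈ ℳ (Z * ξ₀ ^ 2) Y Q (p₁ * a₁) (p₀ * a₀) x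
      rowBelow = ℳ-cong x (trans (reflexive (≡.cong (ξ₀ ^ℤ_) (ξexp-suc-row n k))) (^ℤ-+ℕ ξ₀≉0 (ξexp (suc n) k) 2))
                       (reflexive (≡.cong (x ^ℤ_) (vexp-suc-row n k))) refl (P₁-snoc x) (P₀-snoc x)
      rowAbove : Mhat (suc n) q γ s₀ ξ₀ u′ (inject₁ r) x ≈ ℳ Z (Y * x ^ 1) (q * Q) (p₁ * a₁) (p₀ * a₀) x
      rowAbove = trans
        (reflexive (≡.cong (λ k → ℳ (ξ₀ ^ℤ ξexp (suc n) k) (x ^ℤ vexp (suc n) k) (q ^ (suc n ℕ.∸ suc k))
                                      (P₁ (suc n) u′ x) (P₀ (suc n) u′ x) x) (Finₚ.toℕ-inject₁ r)))
        (ℳ-cong x refl (trans (reflexive (≡.cong (x ^ℤ_) (vexp-pred-size n k))) (^ℤ-+ℕ x≉0 (vexp n k) 1))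
                       (reflexive (≡.cong (q ^_) (ℕₚ.+-∸-assoc 1 (Finₚ.toℕ<n r)))) (P₁-snoc x) (P₀-snoc x))
      smallerRow : Mhat n q γ s₀ ξ₀ u r x ≈ ℳ (Z * ξ₀ ^ 1) Y Q p₁ p₀ x
      smallerRow = ℳ-cong x (trans (reflexive (≡.cong (ξ₀ ^ℤ_) (ξexp-pred-size n k))) (^ℤ-+ℕ ξ₀≉0 (ξexp (suc n) k) 1))
                         refl refl refl refl
      identity : ∀ Z Y Q p₁ p₀ x vi q ξ γ bˡ bʳ cˡ cʳ →
        (Z * (ξ * (ξ * 1#))) * (Y * (bˡ * bʳ * (p₁ * (1# - q * x * vi)) - γ * Q * cˡ * cʳ * (p₀ * (1# - x * vi))))
        - ξ * ξ * vi * (Z * ((Y * (x * 1#)) * (bˡ * bʳ * (p₁ * (1# - q * x * vi))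
                                               - γ * (q * Q) * cˡ * cʳ * (p₀ * (1# - x * vi)))))
        ≈ ξ * ((1# - x * vi) * (1# - q * x * vi)) * ((Z * (ξ * 1#)) * (Y * (bˡ * bʳ * p₁ - γ * Q * cˡ * cʳ * p₀)))
      identity = solve 14 (λ Z Y Q p₁ p₀ x vi q ξ γ bˡ bʳ cˡ cʳ →
        (Z :* (ξ :* (ξ :* con (+ 1)))) :* (Y :* (bˡ :* bʳ :* (p₁ :* (con (+ 1) :- q :* x :* vi))
                                               :- γ :* Q :* cˡ :* cʳ :* (p₀ :* (con (+ 1) :- x :* vi))))
        :- ξ :* ξ :* vi :* (Z :* ((Y :* (x :* con (+ 1))) :* (bˡ :* bʳ :* (p₁ :* (con (+ 1) :- q :* x :* vi))
                                               :- γ :* (q :* Q) :* cˡ :* cʳ :* (p₀ :* (con (+ 1) :- x :* vi)))))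
        := ξ :* ((con (+ 1) :- x :* vi) :* (con (+ 1) :- q :* x :* vi))
             :* ((Z :* (ξ :* con (+ 1))) :* (Y :* (bˡ :* bʳ :* p₁ :- γ :* Q :* cˡ :* cʳ :* p₀)))) refl

    vN*vN⁻¹≈1 : vN * vN ⁻¹ ≈ 1#
    vN*vN⁻¹≈1 = inverse vN vN≉0

    1-vN*vN⁻¹≈0 : 1# - vN * vN ⁻¹ ≈ 0#
    1-vN*vN⁻¹≈0 = trans (+-congˡ (-‿cong vN*vN⁻¹≈1)) (-‿inverseʳ 1#)

    A D : Matrix (suc n)
    A i j = Mhat (suc n) q γ s₀ ξ₀ u′ i (w j)
    D = subtractPreviousRows t A

    D-last-column : ∀ r → D (suc r) (fromℕ n) ≈ 0#
    D-last-column r = begin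
      D (suc r) (fromℕ n)
        ≡⟨ ≡.cong (λ x → Mhat (suc n) q γ s₀ ξ₀ u′ (suc r) x - t * Mhat (suc n) q γ s₀ ξ₀ u′ (inject₁ r) x)
                  (snoc-last n v vN) ⟩
      Mhat (suc n) q γ s₀ ξ₀ u′ (suc r) vN - t * Mhat (suc n) q γ s₀ ξ₀ u′ (inject₁ r) vN
        ≈⟨ Mhat-step r vN vN≉0 ⟩
      columnFactor vN * Mhat n q γ s₀ ξ₀ u r vN
        ≈⟨ *-congʳ (trans (*-congˡ (trans (*-congʳ 1-vN*vN⁻¹≈0) (zeroˡ _))) (zeroʳ _)) ⟩
      0# * Mhat n q γ s₀ ξ₀ u r vN
        ≈⟨ zeroˡ _ ⟩
      0# ∎

    D-minor : ∀ r k → v k ≉ 0# → D (suc r) (inject₁ k) ≈ columnFactor (v k) * Mhat n q γ s₀ ξ₀ u r (v k)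
    D-minor r k vk≉0 = trans
      (reflexive (≡.cong (λ x → Mhat (suc n) q γ s₀ ξ₀ u′ (suc r) x - t * Mhat (suc n) q γ s₀ ξ₀ u′ (inject₁ r) x)
                         (snoc-inject₁ n v vN k)))
      (Mhat-step r (v k) vk≉0)

    Π Pq : Carrier
    Π  = prodF n (λ k → v k - vN)
    Pq = prodF n (λ k → 1# - q * vN ⁻¹ * v k)

    columnFactors : prodF n (columnFactor ∘ v) ≈ sign n * ((ξ₀ * vN ⁻¹) ^ n * (Π * Pq))
    columnFactors = begin
      prodF n (columnFactor ∘ v)            ≈⟨ prodF-cong n (columnFactor≈ ∘ v) ⟩
      prodF n (λ k → - (a * g k))           ≈⟨ prodF-neg n (λ k → a * g k) ⟩
      sign n * prodF n (λ k → a * g k)      ≈⟨ *-congˡ (prodF-distrib-* n (λ _ → a) g) ⟩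
      sign n * (prodF n (λ _ → a) * prodF n g)
        ≈⟨ *-congˡ (*-cong (prodF-const n a) (prodF-distrib-* n (λ k → v k - vN) (λ k → 1# - q * vN ⁻¹ * v k))) ⟩
      sign n * (a ^ n * (Π * Pq))           ∎
      where
      a : Carrier
      a = ξ₀ * vN ⁻¹
      g : Fin n → Carrier
      g k = (v k - vN) * (1# - q * vN ⁻¹ * v k)
      columnFactor≈ : ∀ x → columnFactor x ≈ - (a * ((x - vN) * (1# - q * vN ⁻¹ * x)))
      columnFactor≈ x = trans (*-congˡ (*-congʳ (+-congʳ (sym vN*vN⁻¹≈1))))
        (solve 5 (λ ξ x y vi q → ξ :* ((y :* vi :- x :* vi) :* (con (+ 1) :- q :* x :* vi))
                                := :- (ξ :* vi :* ((x :- y) :* (con (+ 1) :- q :* vi :* x)))) refl ξ₀ x vN (vN ⁻¹) q)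

    firstEntry : Mhat (suc n) q γ s₀ ξ₀ u′ zero vN
      ≈ ξ₀ ^ℤ ξexp (suc n) 0 * (vN ^ℤ vexp (suc n) 0 * (Bˡ vN * Bʳ vN * (P₁ n u vN * (1# - q))))
    firstEntry = trans
      (ℳ-cong vN refl refl refl (trans (P₁-snoc vN) (*-congˡ (+-congˡ (-‿cong q*vN*vN⁻¹≈q))))
                                (trans (P₀-snoc vN) (*-congˡ 1-vN*vN⁻¹≈0)))
      (solve 10 (λ e y bˡ bʳ p₁ γ Q cˡ cʳ p₀ → e :* (y :* (bˡ :* bʳ :* p₁ :- γ :* Q :* cˡ :* cʳ :* (p₀ :* con (+ 0))))
                                            := e :* (y :* (bˡ :* bʳ :* p₁))) refl _ _ _ _ _ _ _ _ _ _)
      where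
      q*vN*vN⁻¹≈q : q * vN * vN ⁻¹ ≈ q
      q*vN*vN⁻¹≈q = trans (*-assoc _ _ _) (trans (*-congˡ vN*vN⁻¹≈1) (*-identityʳ q))

    ξ₀-powers : ξ₀ ^ℤ ξexp (suc n) 0 * ξ₀ ^ n ≈ ξ₀
    ξ₀-powers = begin
      ξ₀ ^ℤ ξexp (suc n) 0 * ξ₀ ^ n   ≈⟨ ^ℤ-+ℕ ξ₀≉0 (ξexp (suc n) 0) n ⟨
      ξ₀ ^ℤ (ξexp (suc n) 0 ℤ.+ + n)  ≡⟨ ≡.cong (ξ₀ ^ℤ_) (ξexp-first n) ⟩
      ξ₀ * 1#                        ≈⟨ *-identityʳ ξ₀ ⟩
      ξ₀                             ∎

    vN-powers : vN ^ℤ vexp (suc n) 0 * (vN ⁻¹) ^ n ≈ vN ⁻¹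
    vN-powers = begin
      vN ^ℤ vexp (suc n) 0 * (vN ⁻¹) ^ n          ≡⟨ ≡.cong (λ e → vN ^ℤ e * (vN ⁻¹) ^ n) (vexp-first n) ⟩
      vN ^ℤ (-[1+ 0 ] ℤ.+ + n) * (vN ⁻¹) ^ n      ≈⟨ *-congʳ (^ℤ-+ℕ vN≉0 -[1+ 0 ] n) ⟩
      vN ⁻¹ * 1# * vN ^ n * (vN ⁻¹) ^ n           ≈⟨ *-assoc _ _ _ ⟩
      vN ⁻¹ * 1# * (vN ^ n * (vN ⁻¹) ^ n)         ≈⟨ *-cong (sym (*-identityʳ _)) (^-distribʳ-* n vN (vN ⁻¹)) ⟨
      vN ⁻¹ * (vN * vN ⁻¹) ^ n                    ≈⟨ *-congˡ (trans (^-congˡ n vN*vN⁻¹≈1) (1^m≈1 n)) ⟩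
      vN ⁻¹ * 1#                                  ≈⟨ *-identityʳ _ ⟩
      vN ⁻¹                                       ∎

    B-factors : ξ₀ * vN ⁻¹ * (Bˡ vN * Bʳ vN) ≈ (1# - s₀ * ξ₀ * γ * vN ⁻¹) * (1# - s₀ * ξ₀ ⁻¹ * γ * vN)
    B-factors = begin
      ξ₀ * vN ⁻¹ * (Bˡ vN * Bʳ vN)
        ≈⟨ solve 6 (λ ξ ξi v vi γ s → ξ :* vi :* ((con (+ 1) :- γ :* s :* ξi :* v) :* (v :* ξi :- γ :* s))
                                     := (ξ :* ξi :* (v :* vi) :- s :* ξ :* γ :* vi) :* (con (+ 1) :- s :* ξi :* γ :* v))
                 refl ξ₀ (ξ₀ ⁻¹) vN (vN ⁻¹) γ s₀ ⟩
      (ξ₀ * ξ₀ ⁻¹ * (vN * vN ⁻¹) - s₀ * ξ₀ * γ * vN ⁻¹) * (1# - s₀ * ξ₀ ⁻¹ * γ * vN)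
        ≈⟨ *-congʳ (+-congʳ (trans (*-cong (inverse ξ₀ ξ₀≉0) vN*vN⁻¹≈1) (*-identityˡ 1#))) ⟩
      (1# - s₀ * ξ₀ * γ * vN ⁻¹) * (1# - s₀ * ξ₀ ⁻¹ * γ * vN) ∎

    κ : Carrier
    κ = (1# - q) * (1# - s₀ * ξ₀ * γ * (vN ⁻¹)) * (1# - s₀ * (ξ₀ ⁻¹) * γ * vN)
        * prodF n (λ j → (1# - q * (vN ⁻¹) * v j) * (1# - q * vN * u j))

    detₙ : Carrier
    detₙ = det n (λ i j → Mhat n q γ s₀ ξ₀ u i (v j))

    det-minor : (∀ k → v k ≉ 0#) →
      det n (λ r k → D (suc r) (inject₁ k)) ≈ sign n * (ξ₀ ^ n * (vN ⁻¹) ^ n * (Π * Pq)) * detₙ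
    det-minor v≉0 = begin
      det n (λ r k → D (suc r) (inject₁ k))
        ≈⟨ det-cong n (λ r k → D-minor r k (v≉0 k)) ⟩
      det n (λ r k → columnFactor (v k) * Mhat n q γ s₀ ξ₀ u r (v k))
        ≈⟨ det-scale-columns n (columnFactor ∘ v) (λ i j → Mhat n q γ s₀ ξ₀ u i (v j)) ⟩
      prodF n (columnFactor ∘ v) * detₙ
        ≈⟨ *-congʳ (trans columnFactors (*-congˡ (*-congʳ (^-distribʳ-* n ξ₀ (vN ⁻¹))))) ⟩
      sign n * (ξ₀ ^ n * (vN ⁻¹) ^ n * (Π * Pq)) * detₙ ∎

    det-Mhat-snoc : (∀ k → v k ≉ 0#) → det (suc n) A ≈ κ * detₙ * Π
    det-Mhat-snoc v≉0 = begin
      det (suc n) A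
        ≈⟨ det-subtractPreviousRows n t A ⟨
      det (suc n) D
        ≈⟨ det-last-column n D D-last-column ⟩
      sign n * (D zero (fromℕ n) * det n (λ r k → D (suc r) (inject₁ k)))
        ≈⟨ *-congˡ (*-cong (trans (reflexive (≡.cong (Mhat (suc n) q γ s₀ ξ₀ u′ zero) (snoc-last n v vN))) firstEntry)
                           (det-minor v≉0)) ⟩
      sign n * (E * (V * (Bˡ vN * Bʳ vN * (p₁ * (1# - q))))
                * (sign n * (ξ₀ ^ n * (vN ⁻¹) ^ n * (Π * Pq)) * detₙ))
        ≈⟨ solve 12 (λ s e y bˡ bʳ p₁ q X W π pq d →
             s :* ((e :* (y :* (bˡ :* bʳ :* (p₁ :* (con (+ 1) :- q))))) :* (s :* (X :* W :* (π :* pq)) :* d))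
             := (con (+ 1) :- q) :* (s :* s :* (e :* X) :* (y :* W) :* (bˡ :* bʳ)) :* (pq :* p₁) :* d :* π)
             refl (sign n) E V (Bˡ vN) (Bʳ vN) p₁ q (ξ₀ ^ n) ((vN ⁻¹) ^ n) Π Pq detₙ ⟩
      (1# - q) * (sign n * sign n * (E * ξ₀ ^ n) * (V * (vN ⁻¹) ^ n) * (Bˡ vN * Bʳ vN)) * (Pq * p₁) * detₙ * Π
        ≈⟨ *-congʳ (*-congʳ (*-cong (*-congˡ (trans (*-congʳ (*-cong (*-cong (sign*sign≈1 n) ξ₀-powers) vN-powers))
                                                    (trans (*-congʳ (*-congʳ (*-identityˡ ξ₀))) B-factors)))
                                    (sym (prodF-distrib-* n _ _)))) ⟩
      (1# - q) * ((1# - s₀ * ξ₀ * γ * vN ⁻¹) * (1# - s₀ * ξ₀ ⁻¹ * γ * vN))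
        * prodF n (λ j → (1# - q * vN ⁻¹ * v j) * (1# - q * vN * u j)) * detₙ * Π
        ≈⟨ *-congʳ (*-congʳ (*-congʳ (sym (*-assoc _ _ _)))) ⟩
      κ * detₙ * Π ∎
      where
      E V p₁ : Carrier
      E = ξ₀ ^ℤ ξexp (suc n) 0
      V = vN ^ℤ vexp (suc n) 0
      p₁ = P₁ n u vN

lemma4p3 : ∀ {c ℓ : Level} (F : Field c ℓ) →
    let open Field F
        open FieldOps F
    in CharZero →
       (n : ℕ) → 1 ≤ n →
       (q γ s₀ ξ₀ : Carrier) → (u v : Fin n → Carrier) → (vN : Carrier) →
       ξ₀ ≉ 0# → vN ≉ 0# → (∀ j → v j ≉ 0#) →
       (∀ i j → i ≢ j → v i ≉ v j) → (∀ j → v j ≉ vN) →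
       scrM (suc n) q γ s₀ ξ₀ (snoc n u (vN ⁻¹)) (snoc n v vN)
         ≈ (1# - q) * (1# - s₀ * ξ₀ * γ * (vN ⁻¹)) * (1# - s₀ * (ξ₀ ⁻¹) * γ * vN)
           * prodF n (λ j → (1# - q * (vN ⁻¹) * v j) * (1# - q * vN * u j))
           * scrM n q γ s₀ ξ₀ u v
lemma4p3 F _ n _ q γ s₀ ξ₀ u v vN ξ₀≉0 vN≉0 v≉0 v-injective v≉vN = begin
  scrM (suc n) q γ s₀ ξ₀ u′ w  ≈⟨ /-cong (*-≉0 V≉0 Π≉0) (det-Mhat-snoc v≉0) (vandermonde-snoc n v vN) ⟩
  (κ * detₙ * Π) / (V * Π)     ≈⟨ /-*-cancelʳ V≉0 Π≉0 ⟩
  (κ * detₙ) / V               ≈⟨ *-assoc κ detₙ (V ⁻¹) ⟩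
  κ * scrM n q γ s₀ ξ₀ u v     ∎
  where
  open Field F
  open FieldOps F
  open Proof F
  open MhatRecursion n q γ s₀ ξ₀ u v vN ξ₀≉0 vN≉0
  open import Relation.Binary.Reasoning.Setoid setoid
  V : Carrier
  V = vandermonde n v
  V≉0 : V ≉ 0#
  V≉0 = vandermonde-≉0 n v v-injective
  Π≉0 : Π ≉ 0#
  Π≉0 = prodF-≉0 n λ k → x≉y⇒x-y≉0 (v≉vN k)
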